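{- For all integers $m\ge3$, $n\ge1$ and $k\ge1$, \[\gamma_{[k]R}(C_m\square P_n)\ge\frac{(k+1)mn}{5}.\]
   Context: $C_m$ is the cycle on $m$ vertices, $P_n$ the path on $n$ vertices, and $\square$ the Cartesian product. For an integer $k\ge1$ and a labeling $f:V(G)\to\{0,1,\dots,k+1\}$, let $AN(v)=\{u\in N(v): f(u)>0\}$. The labeling $f$ is a $[k]$-Roman dominating function if every vertex $v$ with $f(v)<k$ satisfies $f(N[v])\ge k+|AN(v)|$, where $N[v]=N(v)\cup\{v\}$ and $f(X)=\sum_{x\in X}f(x)$. $\gamma_{[k]R}(G)$ is the minimum of $\sum_v f(v)$ over all $[k]$-Roman dominating functions $f$ on $G$. -}

module Defs where

open import Data.Nat using (ℕ; zero; suc; _+_; _*_; _≤_; _<_; _≟_)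
open import Relation.Binary.PropositionalEquality using (_≡_)
open import Data.Fin using (Fin; toℕ)
open import Data.Bool using (Bool; true; false; _∧_; _∨_; if_then_else_)
open import Data.List using (List; map; allFin)
open import Data.Nat.ListAction using (sum)
open import Data.Product using (_×_; _,_; Σ)
open import Relation.Nullary.Decidable using (⌊_⌋)

-- Vertices of C_m □ P_n : pairs (i , j) with i ∈ Z_m (cycle), j ∈ {0..n-1} (path).
Vertex : ℕ → ℕ → Set
Vertex m n = Fin m × Fin n

-- Adjacency in the cycle C_m on Z_m (intended for m ≥ 3):
-- a ~ b iff b ≡ a + 1 (mod m) or a ≡ b + 1 (mod m).
cycAdj : (m : ℕ) → Fin m → Fin m → Bool
cycAdj m a b =
  ⌊ suc (toℕ a) ≟ toℕ b ⌋ ∨ ⌊ suc (toℕ b) ≟ toℕ a ⌋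
  ∨ (⌊ suc (toℕ a) ≟ m ⌋ ∧ ⌊ toℕ b ≟ 0 ⌋)
  ∨ (⌊ suc (toℕ b) ≟ m ⌋ ∧ ⌊ toℕ a ≟ 0 ⌋)

pathAdj : (n : ℕ) → Fin n → Fin n → Bool
pathAdj n a b = ⌊ suc (toℕ a) ≟ toℕ b ⌋ ∨ ⌊ suc (toℕ b) ≟ toℕ a ⌋

eqFin : {p : ℕ} → Fin p → Fin p → Bool
eqFin a b = ⌊ toℕ a ≟ toℕ b ⌋

adj : (m n : ℕ) → Vertex m n → Vertex m n → Bool
adj m n (a , b) (c , d) = (cycAdj m a c ∧ eqFin b d) ∨ (eqFin a c ∧ pathAdj n b d)

allVertices : (m n : ℕ) → List (Vertex m n)
allVertices m n = Data.List.concatMap (λ i → map (λ j → (i , j)) (allFin n)) (allFin m)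

weight : (m n : ℕ) → (Vertex m n → ℕ) → ℕ
weight m n f = sum (map f (allVertices m n))

nbrSum : (m n : ℕ) → (Vertex m n → ℕ) → Vertex m n → ℕ
nbrSum m n f v = sum (map (λ u → if adj m n v u then f u else 0) (allVertices m n))

activeNbrs : (m n : ℕ) → (Vertex m n → ℕ) → Vertex m n → ℕ
activeNbrs m n f v =
  sum (map (λ u → if adj m n v u ∧ ⌊ Data.Nat._<?_ 0 (f u) ⌋ then 1 else 0) (allVertices m n))

record IsKRDF (k m n : ℕ) (f : Vertex m n → ℕ) : Set where
  field
    range : ∀ v → f v ≤ suc k
    dom   : ∀ v → f v < k → k + activeNbrs m n f v ≤ f v + nbrSum m n f v

record IsKRDomNumber (k m n g : ℕ) : Set where
  field
    attained : Σ (Vertex m n → ℕ) (λ f → IsKRDF k m n f × (weight m n f ≡ g))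
    minimal  : ∀ f → IsKRDF k m n f → g ≤ weight m n f

-- Discharging.  Give every vertex w the charge 2 (f(w) + f(N(w))).  Each label is counted once
-- for w itself and once for each of at most four neighbours, so the total charge is at most
-- 10 f(V).  Call a vertex lonely if it is labelled k and has no neighbour of positive label, and
-- let every vertex labelled 0 send one unit to each lonely neighbour.  Afterwards every vertex
-- holds at least 2 (k + 1):
--  * a vertex labelled 0 with P active neighbours, L of them lonely, has
--    k + P ≤ f(N(w)) ≤ (k + 1) P − L, which forces 2 f(N(w)) ≥ 2 (k + 1) + L;
--  * a labelled vertex sends nothing, and unless it is lonely already f(N[w]) ≥ k + 1;
--  * a lonely vertex has at least two neighbours, all labelled 0, and receives one unit from each.
-- Hence 2 (k + 1) m n ≤ 10 f(V).
module Submission where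

open import Defs
open import Algebra.Properties.CommutativeSemigroup using (interchange)
open import Data.Bool using (Bool; true; false; T; if_then_else_; _∧_; _∨_)
open import Data.Bool.Properties using (T-∨; T-∧; ∨-comm)
open import Data.Empty using (⊥-elim)
open import Data.Fin using (Fin; toℕ; fromℕ<) renaming (zero to fzero; suc to fsuc)
open import Data.Fin.Properties using (toℕ<n; toℕ-fromℕ<)
open import Data.List using (List; []; _∷_; _++_; map; concatMap; length; allFin)
open import Data.List.Membership.Propositional using (_∈_)
open import Data.List.Membership.Propositional.Properties using (∈-allFin)
open import Data.List.Properties using (map-++; map-∘; map-cong; map-tabulate; length-tabulate)
open import Data.List.Relation.Unary.Any using (here; there)
open import Data.Nat
  using (ℕ; zero; suc; pred; _+_; _*_; _≤_; _<_; _≥_; _≟_; _<?_; z≤n; s≤s; >-nonZero)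
open import Data.Nat.ListAction using (sum)
open import Data.Nat.ListAction.Properties using (sum-++)
open import Data.Nat.Properties
open import Data.Product using (_×_; _,_; proj₁; proj₂)
open import Data.Sum using (_⊎_; inj₁; inj₂)
import Data.Sum
open import Function using (_∘_; id; case_of_; _⇔_; mk⇔; Equivalence)
open import Relation.Binary.PropositionalEquality
open import Relation.Nullary using (Dec; yes; no; ¬_; contradiction)
open import Relation.Nullary.Decidable using (⌊_⌋; isYes≗does; does-⇔; toWitness; fromWitness)

open Equivalence using (to; from)

ind : Bool → ℕ
ind b = if b then 1 else 0

ind-mono : ∀ {b c} → (T b → T c) → ind b ≤ ind c
ind-mono {false} _ = z≤n
ind-mono {true} {true} _ = ≤-refl
ind-mono {true} {false} b⇒c = ⊥-elim (b⇒c _)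

ind-≤-+ : ∀ {a b c} → (T a → T b ⊎ T c) → ind a ≤ ind b + ind c
ind-≤-+ {false} _ = z≤n
ind-≤-+ {true} {true} _ = s≤s z≤n
ind-≤-+ {true} {false} {true} _ = ≤-refl
ind-≤-+ {true} {false} {false} a⇒b⊎c with a⇒b⊎c _
... | inj₁ ()
... | inj₂ ()

ind-∧ : ∀ a b → ind (a ∧ b) ≡ ind a * ind b
ind-∧ false _ = refl
ind-∧ true b = sym (+-identityʳ (ind b))

ind-T : ∀ {b} → T b → ind b ≡ 1
ind-T {true} _ = refl

ind-F : ∀ {b} → ¬ T b → ind b ≡ 0
ind-F {false} _ = refl
ind-F {true} ¬t = contradiction _ ¬t

ind-∨-∧≤ : ∀ a b c d → ind ((a ∧ b) ∨ (c ∧ d)) ≤ ind a * ind b + ind c * ind d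
ind-∨-∧≤ a b c d = ≤-trans (ind-≤-+ {(a ∧ b) ∨ (c ∧ d)} (to (T-∨ {a ∧ b})))
                           (≤-reflexive (cong₂ _+_ (ind-∧ a b) (ind-∧ c d)))

if-then-0 : ∀ b x → (if b then x else 0) ≡ x * ind b
if-then-0 true x = sym (*-identityʳ x)
if-then-0 false x = sym (*-zeroʳ x)

∨-swap-pairs : ∀ x y z w → x ∨ y ∨ z ∨ w ≡ y ∨ x ∨ w ∨ z
∨-swap-pairs true true _ _ = refl
∨-swap-pairs true false _ _ = refl
∨-swap-pairs false true _ _ = refl
∨-swap-pairs false false z w = ∨-comm z w

⌊⌋-⇔ : ∀ {P Q : Set} → P ⇔ Q → (p? : Dec P) (q? : Dec Q) → ⌊ p? ⌋ ≡ ⌊ q? ⌋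
⌊⌋-⇔ P⇔Q p? q? = trans (isYes≗does p?) (trans (does-⇔ P⇔Q p? q?) (sym (isYes≗does q?)))

module _ {a} {A : Set a} where

  ∑ : List A → (A → ℕ) → ℕ
  ∑ xs g = sum (map g xs)

  syntax ∑ xs (λ x → e) = ∑[ x ∈ xs ] e

  ∑-cong : ∀ xs {g h : A → ℕ} → (∀ x → g x ≡ h x) → ∑ xs g ≡ ∑ xs h
  ∑-cong xs g≗h = cong sum (map-cong g≗h xs)

  ∑-mono : ∀ xs {g h : A → ℕ} → (∀ x → g x ≤ h x) → ∑ xs g ≤ ∑ xs h
  ∑-mono [] g≤h = z≤n
  ∑-mono (x ∷ xs) g≤h = +-mono-≤ (g≤h x) (∑-mono xs g≤h)

  ∑-+ : ∀ xs (g h : A → ℕ) → ∑[ x ∈ xs ] (g x + h x) ≡ ∑ xs g + ∑ xs h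
  ∑-+ [] g h = refl
  ∑-+ (x ∷ xs) g h = trans (cong (g x + h x +_) (∑-+ xs g h))
                           (interchange +-commutativeSemigroup (g x) (h x) (∑ xs g) (∑ xs h))

  ∑-*ˡ : ∀ xs c (g : A → ℕ) → ∑[ x ∈ xs ] (c * g x) ≡ c * ∑ xs g
  ∑-*ˡ [] c g = sym (*-zeroʳ c)
  ∑-*ˡ (x ∷ xs) c g =
    trans (cong (c * g x +_) (∑-*ˡ xs c g)) (sym (*-distribˡ-+ c (g x) (∑ xs g)))

  ∑-const : ∀ xs c → ∑[ x ∈ xs ] c ≡ length xs * c
  ∑-const [] c = refl
  ∑-const (x ∷ xs) c = cong (c +_) (∑-const xs c)

  ∑-zero : ∀ xs → ∑[ x ∈ xs ] 0 ≡ 0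
  ∑-zero xs = trans (∑-const xs 0) (*-zeroʳ (length xs))

  ∑-++ : ∀ xs ys (g : A → ℕ) → ∑ (xs ++ ys) g ≡ ∑ xs g + ∑ ys g
  ∑-++ xs ys g = trans (cong sum (map-++ g xs ys)) (sum-++ (map g xs) (map g ys))

  ∑-≥-∈ : ∀ {x xs} (g : A → ℕ) → x ∈ xs → g x ≤ ∑ xs g
  ∑-≥-∈ g (here refl) = m≤m+n _ _
  ∑-≥-∈ {xs = y ∷ _} g (there x∈xs) = m≤n⇒m≤o+n (g y) (∑-≥-∈ g x∈xs)

  1≤∑-ind : ∀ {x xs} (p : A → Bool) → x ∈ xs → T (p x) → 1 ≤ ∑[ z ∈ xs ] ind (p z)
  1≤∑-ind p x∈xs px = subst (_≤ _) (ind-T px) (∑-≥-∈ (ind ∘ p) x∈xs)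

  2≤∑-ind : ∀ {x y xs} (p : A → Bool) → x ∈ xs → y ∈ xs → x ≢ y → T (p x) → T (p y) →
            2 ≤ ∑[ z ∈ xs ] ind (p z)
  2≤∑-ind p (here refl) (here refl) x≢y _ _ = contradiction refl x≢y
  2≤∑-ind p (here refl) (there y∈xs) _ px py rewrite ind-T px = s≤s (1≤∑-ind p y∈xs py)
  2≤∑-ind p (there x∈xs) (here refl) _ px py rewrite ind-T py = s≤s (1≤∑-ind p x∈xs px)
  2≤∑-ind {xs = z ∷ _} p (there x∈xs) (there y∈xs) x≢y px py =
    m≤n⇒m≤o+n (ind (p z)) (2≤∑-ind p x∈xs y∈xs x≢y px py)

module _ {a b} {A : Set a} {B : Set b} where

  ∑-map : ∀ xs (h : A → B) (g : B → ℕ) → ∑ (map h xs) g ≡ ∑ xs (g ∘ h)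
  ∑-map xs h g = cong sum (sym (map-∘ xs))

  ∑-concatMap : ∀ xs (h : A → List B) (g : B → ℕ) →
                ∑ (concatMap h xs) g ≡ ∑[ x ∈ xs ] ∑ (h x) g
  ∑-concatMap [] h g = refl
  ∑-concatMap (x ∷ xs) h g =
    trans (∑-++ (h x) (concatMap h xs) g) (cong (∑ (h x) g +_) (∑-concatMap xs h g))

  ∑-comm : ∀ xs ys (g : A → B → ℕ) →
           ∑[ x ∈ xs ] ∑[ y ∈ ys ] g x y ≡ ∑[ y ∈ ys ] ∑[ x ∈ xs ] g x y
  ∑-comm [] ys g = sym (∑-zero ys)
  ∑-comm (x ∷ xs) ys g = trans (cong (∑ ys (g x) +_) (∑-comm xs ys g)) (sym (∑-+ ys (g x) _))

∑-allFin-suc : ∀ n (g : Fin (suc n) → ℕ) →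
               ∑ (allFin (suc n)) g ≡ g fzero + ∑[ i ∈ allFin n ] g (fsuc i)
∑-allFin-suc n g = cong (λ xs → g fzero + sum xs)
  (trans (map-tabulate fsuc g) (sym (map-tabulate id (g ∘ fsuc))))

count-≟≤1 : ∀ n a → ∑[ i ∈ allFin n ] ind ⌊ toℕ i ≟ a ⌋ ≤ 1
count-≟≤1 zero a = z≤n
count-≟≤1 (suc n) zero rewrite ∑-allFin-suc n (λ i → ind ⌊ toℕ i ≟ 0 ⌋) =
  ≤-reflexive (cong suc (∑-zero (allFin n)))
count-≟≤1 (suc n) (suc a) rewrite ∑-allFin-suc n (λ i → ind ⌊ toℕ i ≟ suc a ⌋) =
  ≤-trans (∑-mono (allFin n) λ i → ind-mono (fromWitness ∘ suc-injective ∘ toWitness))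
          (count-≟≤1 n a)

count≤2 : ∀ {n} a b (p : Fin n → Bool) → (∀ i → T (p i) → toℕ i ≡ a ⊎ toℕ i ≡ b) →
          ∑[ i ∈ allFin n ] ind (p i) ≤ 2
count≤2 {n} a b p p⇒a⊎b = begin
  ∑[ i ∈ allFin n ] ind (p i)
    ≤⟨ ∑-mono (allFin n) (λ i → ind-≤-+ {p i} {⌊ toℕ i ≟ a ⌋} {⌊ toℕ i ≟ b ⌋}
         λ t → Data.Sum.map fromWitness fromWitness (p⇒a⊎b i t)) ⟩
  ∑[ i ∈ allFin n ] (ind ⌊ toℕ i ≟ a ⌋ + ind ⌊ toℕ i ≟ b ⌋)
    ≡⟨ ∑-+ (allFin n) _ _ ⟩
  ∑[ i ∈ allFin n ] ind ⌊ toℕ i ≟ a ⌋ + ∑[ i ∈ allFin n ] ind ⌊ toℕ i ≟ b ⌋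
    ≤⟨ +-mono-≤ (count-≟≤1 n a) (count-≟≤1 n b) ⟩
  2 ∎
  where open ≤-Reasoning

ind-positive≤ : ∀ x → ind ⌊ 0 <? x ⌋ ≤ x
ind-positive≤ zero = z≤n
ind-positive≤ (suc x) = s≤s z≤n

label+ind≤ : ∀ {k} x l → 1 ≤ k → x ≤ suc k → (T l → x ≡ k) →
             x + ind l ≤ (k + 1) * ind ⌊ 0 <? x ⌋
label+ind≤ zero false _ _ _ = z≤n
label+ind≤ zero true 1≤k _ l⇒x≡k = contradiction (subst (1 ≤_) (sym (l⇒x≡k _)) 1≤k) λ ()
label+ind≤ {k} (suc x) false _ x≤1+k _ =
  subst₂ _≤_ (sym (+-identityʳ (suc x))) (trans (+-comm 1 k) (sym (*-identityʳ (k + 1)))) x≤1+k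
label+ind≤ {k} (suc x) true _ _ l⇒x≡k =
  ≤-reflexive (trans (cong (_+ 1) (l⇒x≡k _)) (sym (*-identityʳ (k + 1))))

2+lonely≤2*active : ∀ {k P L F} → 1 ≤ k → k + P ≤ F → F + L ≤ (k + 1) * P → L ≤ P →
                    2 + L ≤ 2 * P
2+lonely≤2*active {k} {zero} {L} {F} 1≤k k+P≤F F+L≤ _ = contradiction 1≤0 λ ()
  where
  1≤0 : 1 ≤ 0
  1≤0 = ≤-trans 1≤k (≤-trans (m≤m+n k 0) (≤-trans k+P≤F (≤-trans (m≤m+n F L)
          (≤-trans F+L≤ (≤-reflexive (*-zeroʳ (k + 1)))))))
2+lonely≤2*active {k} {suc zero} {L} {F} _ k+P≤F F+L≤ _ = +-monoʳ-≤ 2 L≤0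
  where
  L≤0 : L ≤ 0
  L≤0 = +-cancelˡ-≤ (k + 1) L 0 (≤-trans (+-monoˡ-≤ L k+P≤F)
          (≤-trans F+L≤ (≤-reflexive (trans (*-identityʳ (k + 1)) (sym (+-identityʳ (k + 1)))))))
2+lonely≤2*active {P = suc (suc p)} _ _ _ L≤P = +-mono-≤ (m≤m+n 2 p) (m≤n⇒m≤n+o 0 L≤P)

unlabelled-surplus : ∀ {k P L F} → k + P ≤ F → 2 + L ≤ 2 * P → 2 * (k + 1) + L ≤ 2 * F
unlabelled-surplus {k} {P} {L} {F} k+P≤F 2+L≤2P = begin
  2 * (k + 1) + L ≡⟨ cong (_+ L) (*-distribˡ-+ 2 k 1) ⟩
  2 * k + 2 + L   ≡⟨ +-assoc (2 * k) 2 L ⟩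
  2 * k + (2 + L) ≤⟨ +-monoʳ-≤ (2 * k) 2+L≤2P ⟩
  2 * k + 2 * P   ≡⟨ *-distribˡ-+ 2 k P ⟨
  2 * (k + P)     ≤⟨ *-monoʳ-≤ 2 k+P≤F ⟩
  2 * F           ∎
  where open ≤-Reasoning

module RomanDischarging {a} {Vtx : Set a} (V : List Vtx) (_~_ : Vtx → Vtx → Bool)
                        (~-sym : ∀ u v → u ~ v ≡ v ~ u) where

  degree : Vtx → ℕ
  degree u = ∑[ v ∈ V ] ind (v ~ u)

  nbrWeight : (Vtx → ℕ) → Vtx → ℕ
  nbrWeight f v = ∑[ u ∈ V ] (if v ~ u then f u else 0)

  activeNbrCount : (Vtx → ℕ) → Vtx → ℕ
  activeNbrCount f v = ∑[ u ∈ V ] ind (v ~ u ∧ ⌊ 0 <? f u ⌋)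

  ∑-nbrWeight : ∀ f → ∑ V (nbrWeight f) ≡ ∑[ u ∈ V ] (f u * degree u)
  ∑-nbrWeight f = trans (∑-comm V V (λ v u → if v ~ u then f u else 0))
    (∑-cong V λ u → trans (∑-cong V λ v → if-then-0 (v ~ u) (f u)) (∑-*ˡ V (f u) _))

  module _ {k : ℕ} {f : Vtx → ℕ} (1≤k : 1 ≤ k) (bounded : ∀ v → f v ≤ suc k)
           (dominating : ∀ v → f v < k → k + activeNbrCount f v ≤ f v + nbrWeight f v) where

    private
      F P : Vtx → ℕ
      F = nbrWeight f
      P = activeNbrCount f

    lonely : Vtx → Bool
    lonely u = ⌊ f u ≟ k ⌋ ∧ ⌊ P u ≟ 0 ⌋

    lonelyNbrCount : Vtx → ℕ
    lonelyNbrCount w = ∑[ u ∈ V ] ind (w ~ u ∧ lonely u)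

    transfer : Vtx → Vtx → ℕ
    transfer w u = ind (w ~ u ∧ ⌊ f w ≟ 0 ⌋ ∧ lonely u)

    sent received : Vtx → ℕ
    sent w = ∑[ u ∈ V ] transfer w u
    received u = ∑[ w ∈ V ] transfer w u

    lonely⇒≡k : ∀ {u} → T (lonely u) → f u ≡ k
    lonely⇒≡k {u} = toWitness ∘ proj₁ ∘ to (T-∧ {⌊ f u ≟ k ⌋})

    nbrWeight+lonely≤ : ∀ w → F w + lonelyNbrCount w ≤ (k + 1) * P w
    nbrWeight+lonely≤ w = begin
      F w + lonelyNbrCount w
        ≡⟨ ∑-+ V _ _ ⟨
      ∑[ u ∈ V ] ((if w ~ u then f u else 0) + ind (w ~ u ∧ lonely u))
        ≤⟨ ∑-mono V pointwise ⟩
      ∑[ u ∈ V ] ((k + 1) * ind (w ~ u ∧ ⌊ 0 <? f u ⌋))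
        ≡⟨ ∑-*ˡ V (k + 1) _ ⟩
      (k + 1) * P w ∎
      where
      open ≤-Reasoning
      pointwise : ∀ u → (if w ~ u then f u else 0) + ind (w ~ u ∧ lonely u)
                        ≤ (k + 1) * ind (w ~ u ∧ ⌊ 0 <? f u ⌋)
      pointwise u with w ~ u
      ... | false = z≤n
      ... | true = label+ind≤ (f u) (lonely u) 1≤k (bounded u) lonely⇒≡k

    lonelyNbrCount≤activeNbrCount : ∀ w → lonelyNbrCount w ≤ P w
    lonelyNbrCount≤activeNbrCount w = ∑-mono V λ u → ind-mono {w ~ u ∧ lonely u} λ t →
      let (w~u , lu) = to (T-∧ {w ~ u}) t in
      from (T-∧ {w ~ u}) (w~u , fromWitness (subst (0 <_) (sym (lonely⇒≡k lu)) 1≤k))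

    activeNbrCount≤nbrWeight : ∀ w → P w ≤ F w
    activeNbrCount≤nbrWeight w = ∑-mono V pointwise
      where
      pointwise : ∀ u → ind (w ~ u ∧ ⌊ 0 <? f u ⌋) ≤ (if w ~ u then f u else 0)
      pointwise u with w ~ u
      ... | false = z≤n
      ... | true = ind-positive≤ (f u)

    sent-unlabelled : ∀ w → f w ≡ 0 → sent w ≡ lonelyNbrCount w
    sent-unlabelled w fw≡0 rewrite fw≡0 = refl

    sent-labelled : ∀ w → f w ≢ 0 → sent w ≡ 0
    sent-labelled w fw≢0 = trans (∑-cong V λ u → ind-F λ t →
        fw≢0 (toWitness (proj₁ (to (T-∧ {⌊ f w ≟ 0 ⌋}) (proj₂ (to (T-∧ {w ~ u}) t))))))
      (∑-zero V)

    received≥degree : ∀ w → T (lonely w) → degree w ≤ received w + P w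
    received≥degree w lw = ≤-trans
      (∑-mono V λ u →
        ind-≤-+ {u ~ w} {u ~ w ∧ ⌊ f u ≟ 0 ⌋ ∧ lonely w} {w ~ u ∧ ⌊ 0 <? f u ⌋} (split u))
      (≤-reflexive (∑-+ V _ _))
      where
      split : ∀ u → T (u ~ w) →
              T (u ~ w ∧ ⌊ f u ≟ 0 ⌋ ∧ lonely w) ⊎ T (w ~ u ∧ ⌊ 0 <? f u ⌋)
      split u u~w with f u
      ... | zero = inj₁ (from (T-∧ {u ~ w}) (u~w , lw))
      ... | suc _ = inj₂ (from (T-∧ {w ~ u}) (subst T (~-sym u w) u~w , _))

    lonely-or-covered : ∀ w → (f w ≡ k × P w ≡ 0) ⊎ k + 1 ≤ f w + F w
    lonely-or-covered w with f w <? k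
    ... | yes fw<k = inj₂ (≤-trans (+-monoʳ-≤ k (n≢0⇒n>0 P≢0)) (dominating w fw<k))
      where
      P≢0 : P w ≢ 0
      P≢0 P≡0 = <⇒≱ fw<k (begin
        k                   ≤⟨ m≤m+n k (P w) ⟩
        k + P w             ≤⟨ dominating w fw<k ⟩
        f w + F w           ≤⟨ +-monoʳ-≤ (f w) (m+n≤o⇒m≤o (F w) (nbrWeight+lonely≤ w)) ⟩
        f w + (k + 1) * P w ≡⟨ cong (λ p → f w + (k + 1) * p) P≡0 ⟩
        f w + (k + 1) * 0   ≡⟨ cong (f w +_) (*-zeroʳ (k + 1)) ⟩
        f w + 0             ≡⟨ +-identityʳ (f w) ⟩
        f w                 ∎)
        where open ≤-Reasoning
    ... | no fw≮k with f w ≟ k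
    ...   | no fw≢k = inj₂ (≤-trans (≤-reflexive (+-comm k 1))
                             (≤-trans (≤∧≢⇒< (≮⇒≥ fw≮k) (fw≢k ∘ sym)) (m≤m+n (f w) (F w))))
    ...   | yes fw≡k with P w ≟ 0
    ...     | yes P≡0 = inj₁ (fw≡k , P≡0)
    ...     | no P≢0 = inj₂ (subst (λ x → k + 1 ≤ x + F w) (sym fw≡k)
                               (+-monoʳ-≤ k (≤-trans (n≢0⇒n>0 P≢0) (activeNbrCount≤nbrWeight w))))

    charge-unlabelled : ∀ w → f w ≡ 0 →
                        2 * (k + 1) + sent w ≤ 2 * (f w + F w) + received w
    charge-unlabelled w fw≡0 = begin
      2 * (k + 1) + sent w           ≡⟨ cong (2 * (k + 1) +_) (sent-unlabelled w fw≡0) ⟩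
      2 * (k + 1) + lonelyNbrCount w ≤⟨ unlabelled-surplus {k} {P w} k+P≤F 2+L≤2P ⟩
      2 * F w                        ≤⟨ *-monoʳ-≤ 2 (m≤n+m (F w) (f w)) ⟩
      2 * (f w + F w)                ≤⟨ m≤m+n _ _ ⟩
      2 * (f w + F w) + received w   ∎
      where
      open ≤-Reasoning
      k+P≤F : k + P w ≤ F w
      k+P≤F = subst (λ x → k + P w ≤ x + F w) fw≡0 (dominating w (subst (_< k) (sym fw≡0) 1≤k))
      2+L≤2P : 2 + lonelyNbrCount w ≤ 2 * P w
      2+L≤2P = 2+lonely≤2*active 1≤k k+P≤F (nbrWeight+lonely≤ w) (lonelyNbrCount≤activeNbrCount w)

    charge-labelled : ∀ w → 2 ≤ degree w → f w ≢ 0 →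
                      2 * (k + 1) + sent w ≤ 2 * (f w + F w) + received w
    charge-labelled w 2≤deg fw≢0 rewrite sent-labelled w fw≢0 with lonely-or-covered w
    ... | inj₂ covered =
      ≤-trans (≤-reflexive (+-identityʳ _)) (≤-trans (*-monoʳ-≤ 2 covered) (m≤m+n _ _))
    ... | inj₁ (fw≡k , P≡0) = begin
      2 * (k + 1) + 0               ≡⟨ trans (+-identityʳ _) (*-distribˡ-+ 2 k 1) ⟩
      2 * k + 2                     ≤⟨ +-mono-≤ (*-monoʳ-≤ 2 k≤f+F) 2≤received ⟩
      2 * (f w + F w) + received w  ∎
      where
      open ≤-Reasoning
      k≤f+F : k ≤ f w + F w
      k≤f+F = ≤-trans (≤-reflexive (sym fw≡k)) (m≤m+n (f w) (F w))
      2≤received : 2 ≤ received w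
      2≤received = ≤-trans 2≤deg (≤-trans
        (received≥degree w (from (T-∧ {⌊ f w ≟ k ⌋}) (fromWitness fw≡k , fromWitness P≡0)))
        (≤-reflexive (trans (cong (received w +_) P≡0) (+-identityʳ _))))

    charge-after-transfer : ∀ w → 2 ≤ degree w →
                            2 * (k + 1) + sent w ≤ 2 * (f w + F w) + received w
    charge-after-transfer w 2≤deg = case f w ≟ 0 of λ where
      (yes fw≡0) → charge-unlabelled w fw≡0
      (no fw≢0) → charge-labelled w 2≤deg fw≢0

    weight-bound : ∀ Δ → (∀ u → 2 ≤ degree u) → (∀ u → degree u ≤ Δ) →
                   (k + 1) * length V ≤ suc Δ * ∑ V f
    weight-bound Δ 2≤degree degree≤Δ = *-cancelˡ-≤ 2 (begin
      2 * ((k + 1) * length V)  ≤⟨ +-cancelʳ-≤ (∑ V sent) _ _ summed ⟩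
      2 * (∑ V f + ∑ V F)       ≤⟨ *-monoʳ-≤ 2 (+-monoʳ-≤ (∑ V f) ∑F≤Δ*W) ⟩
      2 * (suc Δ * ∑ V f)       ∎)
      where
      open ≤-Reasoning
      ∑F≤Δ*W : ∑ V F ≤ Δ * ∑ V f
      ∑F≤Δ*W = begin
        ∑ V F                       ≡⟨ ∑-nbrWeight f ⟩
        ∑[ u ∈ V ] (f u * degree u) ≤⟨ ∑-mono V (λ u → ≤-trans (*-monoʳ-≤ (f u) (degree≤Δ u))
                                                              (≤-reflexive (*-comm (f u) Δ))) ⟩
        ∑[ u ∈ V ] (Δ * f u)        ≡⟨ ∑-*ˡ V Δ f ⟩
        Δ * ∑ V f                   ∎
      summed : 2 * ((k + 1) * length V) + ∑ V sent ≤ 2 * (∑ V f + ∑ V F) + ∑ V sent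
      summed = begin
        2 * ((k + 1) * length V) + ∑ V sent
          ≡⟨ cong (_+ ∑ V sent) (trans (sym (*-assoc 2 (k + 1) (length V)))
               (trans (*-comm _ (length V)) (sym (∑-const V _)))) ⟩
        ∑[ w ∈ V ] (2 * (k + 1)) + ∑ V sent
          ≡⟨ ∑-+ V _ sent ⟨
        ∑[ w ∈ V ] (2 * (k + 1) + sent w)
          ≤⟨ ∑-mono V (λ w → charge-after-transfer w (2≤degree w)) ⟩
        ∑[ w ∈ V ] (2 * (f w + F w) + received w)
          ≡⟨ ∑-+ V _ received ⟩
        ∑[ w ∈ V ] (2 * (f w + F w)) + ∑ V received
          ≡⟨ cong₂ _+_ (trans (∑-*ˡ V 2 _) (cong (2 *_) (∑-+ V f F)))
                       (sym (∑-comm V V transfer)) ⟩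
        2 * (∑ V f + ∑ V F) + ∑ V sent ∎

finDegree : ∀ {p} → (Fin p → Fin p → Bool) → Fin p → ℕ
finDegree {p} G c = ∑[ i ∈ allFin p ] ind (G i c)

eqFin-sym : ∀ {p} (a b : Fin p) → eqFin a b ≡ eqFin b a
eqFin-sym a b = ⌊⌋-⇔ (mk⇔ sym sym) (toℕ a ≟ toℕ b) (toℕ b ≟ toℕ a)

module _ {m n : ℕ} where

  infixr 5 _□_
  _□_ : (Fin m → Fin m → Bool) → (Fin n → Fin n → Bool) → Vertex m n → Vertex m n → Bool
  (G □ H) (a , b) (c , d) = (G a c ∧ eqFin b d) ∨ (eqFin a c ∧ H b d)

  □-sym : ∀ {G H} → (∀ a c → G a c ≡ G c a) → (∀ b d → H b d ≡ H d b) →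
          ∀ v u → (G □ H) v u ≡ (G □ H) u v
  □-sym G-sym H-sym (a , b) (c , d)
    rewrite G-sym a c | H-sym b d | eqFin-sym a c | eqFin-sym b d = refl

  ∑-allVertices : (g : Vertex m n → ℕ) →
                  ∑ (allVertices m n) g ≡ ∑[ i ∈ allFin m ] ∑[ j ∈ allFin n ] g (i , j)
  ∑-allVertices g = trans (∑-concatMap (allFin m) _ g)
                          (∑-cong (allFin m) λ i → ∑-map (allFin n) (i ,_) g)

  length-allVertices : length (allVertices m n) ≡ m * n
  length-allVertices = begin
    length (allVertices m n)                    ≡⟨ *-identityʳ _ ⟨
    length (allVertices m n) * 1                ≡⟨ ∑-const (allVertices m n) 1 ⟨
    ∑[ v ∈ allVertices m n ] 1                  ≡⟨ ∑-allVertices (λ _ → 1) ⟩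
    ∑[ i ∈ allFin m ] ∑[ j ∈ allFin n ] 1       ≡⟨ ∑-cong (allFin m) (λ _ → ∑-const (allFin n) 1) ⟩
    ∑[ i ∈ allFin m ] (length (allFin n) * 1)   ≡⟨ ∑-const (allFin m) _ ⟩
    length (allFin m) * (length (allFin n) * 1) ≡⟨ cong₂ (λ a b → a * (b * 1))
                                                     (length-tabulate {n = m} id)
                                                     (length-tabulate {n = n} id) ⟩
    m * (n * 1)                                 ≡⟨ cong (m *_) (*-identityʳ n) ⟩
    m * n                                       ∎
    where open ≡-Reasoning

  module _ (G : Fin m → Fin m → Bool) (H : Fin n → Fin n → Bool) (c : Fin m) (d : Fin n) where

    □-degree : ℕ
    □-degree = ∑[ v ∈ allVertices m n ] ind ((G □ H) v (c , d))

    □-degree≤ : □-degree ≤ finDegree G c + finDegree H d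
    □-degree≤ = begin
      □-degree
        ≡⟨ ∑-allVertices _ ⟩
      ∑[ i ∈ allFin m ] ∑[ j ∈ allFin n ] ind ((G □ H) (i , j) (c , d))
        ≤⟨ ∑-mono (allFin m) (λ i → ∑-mono (allFin n) λ j →
             ind-∨-∧≤ (G i c) (eqFin j d) (eqFin i c) (H j d)) ⟩
      ∑[ i ∈ allFin m ] ∑[ j ∈ allFin n ] (a i * ind (eqFin j d) + δ i * ind (H j d))
        ≡⟨ ∑-cong (allFin m) (λ i → trans (∑-+ (allFin n) _ _)
             (cong₂ _+_ (∑-*ˡ (allFin n) (a i) _) (∑-*ˡ (allFin n) (δ i) _))) ⟩
      ∑[ i ∈ allFin m ] (a i * ∑[ j ∈ allFin n ] ind (eqFin j d) + δ i * finDegree H d)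
        ≤⟨ ∑-mono (allFin m) (λ i → +-mono-≤ (*-≤1 (a i) (count-≟≤1 n (toℕ d)))
                                               (≤-reflexive (*-comm (δ i) (finDegree H d)))) ⟩
      ∑[ i ∈ allFin m ] (a i + finDegree H d * δ i)
        ≡⟨ trans (∑-+ (allFin m) _ _) (cong (finDegree G c +_) (∑-*ˡ (allFin m) (finDegree H d) δ)) ⟩
      finDegree G c + finDegree H d * ∑ (allFin m) δ
        ≤⟨ +-monoʳ-≤ (finDegree G c) (*-≤1 (finDegree H d) (count-≟≤1 m (toℕ c))) ⟩
      finDegree G c + finDegree H d ∎
      where
      open ≤-Reasoning
      a δ : Fin m → ℕ
      a i = ind (G i c)
      δ i = ind (eqFin i c)
      *-≤1 : ∀ x {y} → y ≤ 1 → x * y ≤ x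
      *-≤1 x y≤1 = ≤-trans (*-monoʳ-≤ x y≤1) (≤-reflexive (*-identityʳ x))

    finDegree≤□-degree : finDegree G c ≤ □-degree
    finDegree≤□-degree = begin
      finDegree G c
        ≤⟨ ∑-mono (allFin m) (λ i →
             ≤-trans (ind-mono {G i c} (G-edge i)) (∑-≥-∈ (row i) (∈-allFin d))) ⟩
      ∑[ i ∈ allFin m ] ∑[ j ∈ allFin n ] row i j
        ≡⟨ ∑-allVertices _ ⟨
      □-degree ∎
      where
      open ≤-Reasoning
      row : Fin m → Fin n → ℕ
      row i j = ind ((G □ H) (i , j) (c , d))
      G-edge : ∀ i → T (G i c) → T ((G □ H) (i , d) (c , d))
      G-edge i t = from (T-∨ {G i c ∧ eqFin d d}) (inj₁ (from (T-∧ {G i c}) (t , fromWitness refl)))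

pathAdj-sym : ∀ n (a b : Fin n) → pathAdj n a b ≡ pathAdj n b a
pathAdj-sym n a b = ∨-comm ⌊ suc (toℕ a) ≟ toℕ b ⌋ ⌊ suc (toℕ b) ≟ toℕ a ⌋

pathAdj⇒ : ∀ {n} (j d : Fin n) → T (pathAdj n j d) →
           toℕ j ≡ pred (toℕ d) ⊎ toℕ j ≡ suc (toℕ d)
pathAdj⇒ j d t with to (T-∨ {⌊ suc (toℕ j) ≟ toℕ d ⌋}) t
... | inj₁ j+1≡d = inj₁ (cong pred (toWitness j+1≡d))
... | inj₂ d+1≡j = inj₂ (sym (toWitness d+1≡j))

pathDegree≤2 : ∀ {n} (d : Fin n) → finDegree (pathAdj n) d ≤ 2
pathDegree≤2 {n} d =
  count≤2 (pred (toℕ d)) (suc (toℕ d)) (λ j → pathAdj n j d) (λ j → pathAdj⇒ j d)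

module _ (m : ℕ) where

  isSucc wraps : Fin m → Fin m → Bool
  isSucc i c = ⌊ suc (toℕ i) ≟ toℕ c ⌋
  wraps i c = ⌊ suc (toℕ i) ≟ m ⌋ ∧ ⌊ toℕ c ≟ 0 ⌋

  cycAdj-sym : ∀ a b → cycAdj m a b ≡ cycAdj m b a
  cycAdj-sym a b = ∨-swap-pairs (isSucc a b) (isSucc b a) (wraps a b) (wraps b a)

  cycPred : ℕ → ℕ
  cycPred zero = pred m
  cycPred (suc c) = c

  cycSucc : ℕ → ℕ
  cycSucc c with suc c ≟ m
  ... | yes _ = 0
  ... | no _ = suc c

  cycSucc-wrap : ∀ {c} → suc c ≡ m → cycSucc c ≡ 0
  cycSucc-wrap {c} c+1≡m with suc c ≟ m
  ... | yes _ = refl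
  ... | no c+1≢m = contradiction c+1≡m c+1≢m

  cycSucc-step : ∀ {c} → suc c ≢ m → cycSucc c ≡ suc c
  cycSucc-step {c} c+1≢m with suc c ≟ m
  ... | yes c+1≡m = contradiction c+1≡m c+1≢m
  ... | no _ = refl

  cycPred< : ∀ {c} → c < m → cycPred c < m
  cycPred< {zero} 0<m = ≤-reflexive (suc-pred m {{>-nonZero 0<m}})
  cycPred< {suc c} c+1<m = <-trans (n<1+n c) c+1<m

  cycSucc< : ∀ {c} → c < m → cycSucc c < m
  cycSucc< {c} c<m = case suc c ≟ m of λ where
    (yes c+1≡m) → subst (_< m) (sym (cycSucc-wrap c+1≡m)) (≤-trans (s≤s z≤n) c<m)
    (no c+1≢m) → subst (_< m) (sym (cycSucc-step c+1≢m)) (≤∧≢⇒< c<m c+1≢m)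

  cycPred≢cycSucc : 3 ≤ m → ∀ c → cycPred c ≢ cycSucc c
  cycPred≢cycSucc 3≤m zero e = case 1 ≟ m of λ where
      (yes 1≡m) → below3 (s≤s (s≤s z≤n)) 1≡m
      (no 1≢m) → below3 ≤-refl (trans (cong suc (sym (trans e (cycSucc-step 1≢m))))
                                       (suc-pred m {{>-nonZero (≤-trans (s≤s z≤n) 3≤m)}}))
    where
    below3 : ∀ {x} → x < 3 → x ≢ m
    below3 x<3 x≡m = <⇒≱ x<3 (subst (3 ≤_) (sym x≡m) 3≤m)
  cycPred≢cycSucc 3≤m (suc c) e = case suc (suc c) ≟ m of λ where
      (yes c+2≡m) → <⇒≱ ≤-refl (subst (3 ≤_)
                       (trans (sym c+2≡m) (cong (suc ∘ suc) (trans e (cycSucc-wrap c+2≡m)))) 3≤m)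
      (no c+2≢m) → <⇒≢ (n≤1+n (suc c)) (trans e (cycSucc-step c+2≢m))

  cycAdj⇒ : (i c : Fin m) → T (cycAdj m i c) →
            toℕ i ≡ cycPred (toℕ c) ⊎ toℕ i ≡ cycSucc (toℕ c)
  cycAdj⇒ i c t with to (T-∨ {isSucc i c}) t
  ... | inj₁ i+1≡c = inj₁ (cong cycPred (toWitness i+1≡c))
  ... | inj₂ t′ with to (T-∨ {isSucc c i}) t′
  ...   | inj₁ c+1≡i = inj₂ (trans (sym (toWitness c+1≡i)) (sym (cycSucc-step c+1≢m)))
    where
    c+1≢m : suc (toℕ c) ≢ m
    c+1≢m c+1≡m = <-irrefl (trans (sym (toWitness c+1≡i)) c+1≡m) (toℕ<n i)
  ...   | inj₂ t″ with to (T-∨ {wraps i c}) t″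
  ...     | inj₁ i↷c = let (i+1≡m , c≡0) = to (T-∧ {⌊ suc (toℕ i) ≟ m ⌋}) i↷c in
    inj₁ (trans (cong pred (toWitness i+1≡m)) (cong cycPred (sym (toWitness c≡0))))
  ...     | inj₂ c↷i = let (c+1≡m , i≡0) = to (T-∧ {⌊ suc (toℕ c) ≟ m ⌋}) c↷i in
    inj₂ (trans (toWitness i≡0) (sym (cycSucc-wrap (toWitness c+1≡m))))

  cycAdj⇐pred : (i c : Fin m) → toℕ i ≡ cycPred (toℕ c) → T (cycAdj m i c)
  cycAdj⇐pred i c = go (toℕ c) refl
    where
    go : ∀ x → x ≡ toℕ c → toℕ i ≡ cycPred x → T (cycAdj m i c)
    go zero 0≡c i≡m-1 =
      from (T-∨ {isSucc i c}) (inj₂ (from (T-∨ {isSucc c i}) (inj₂ (from (T-∨ {wraps i c}) (inj₁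
        (from (T-∧ {⌊ suc (toℕ i) ≟ m ⌋}) (fromWitness i+1≡m , fromWitness (sym 0≡c))))))))
      where
      i+1≡m : suc (toℕ i) ≡ m
      i+1≡m = trans (cong suc i≡m-1) (suc-pred m {{>-nonZero (≤-trans (s≤s z≤n) (toℕ<n i))}})
    go (suc x) x+1≡c i≡x = from (T-∨ {isSucc i c}) (inj₁ (fromWitness (trans (cong suc i≡x) x+1≡c)))

  cycAdj⇐succ : (i c : Fin m) → toℕ i ≡ cycSucc (toℕ c) → T (cycAdj m i c)
  cycAdj⇐succ i c i≡c⁺ = from (T-∨ {isSucc i c}) (inj₂ (from (T-∨ {isSucc c i})
    (case suc (toℕ c) ≟ m of λ where
      (yes c+1≡m) → inj₂ (from (T-∨ {wraps i c}) (inj₂ (from (T-∧ {⌊ suc (toℕ c) ≟ m ⌋})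
                      (fromWitness c+1≡m , fromWitness (trans i≡c⁺ (cycSucc-wrap c+1≡m))))))
      (no c+1≢m) → inj₁ (fromWitness (sym (trans i≡c⁺ (cycSucc-step c+1≢m)))))))

  cycDegree≤2 : ∀ c → finDegree (cycAdj m) c ≤ 2
  cycDegree≤2 c =
    count≤2 (cycPred (toℕ c)) (cycSucc (toℕ c)) (λ i → cycAdj m i c) (λ i → cycAdj⇒ i c)

  2≤cycDegree : 3 ≤ m → ∀ c → 2 ≤ finDegree (cycAdj m) c
  2≤cycDegree 3≤m c = 2≤∑-ind (λ i → cycAdj m i c) (∈-allFin c⁻) (∈-allFin c⁺) c⁻≢c⁺
    (cycAdj⇐pred c⁻ c (toℕ-fromℕ< _)) (cycAdj⇐succ c⁺ c (toℕ-fromℕ< _))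
    where
    c⁻ c⁺ : Fin m
    c⁻ = fromℕ< (cycPred< (toℕ<n c))
    c⁺ = fromℕ< (cycSucc< (toℕ<n c))
    c⁻≢c⁺ : c⁻ ≢ c⁺
    c⁻≢c⁺ c⁻≡c⁺ = cycPred≢cycSucc 3≤m (toℕ c)
      (trans (sym (toℕ-fromℕ< _)) (trans (cong toℕ c⁻≡c⁺) (toℕ-fromℕ< _)))

module _ {m n : ℕ} (c : Fin m) (d : Fin n) where

  gridDegree≤4 : □-degree (cycAdj m) (pathAdj n) c d ≤ 4
  gridDegree≤4 = ≤-trans (□-degree≤ (cycAdj m) (pathAdj n) c d)
                         (+-mono-≤ (cycDegree≤2 m c) (pathDegree≤2 d))

  2≤gridDegree : 3 ≤ m → 2 ≤ □-degree (cycAdj m) (pathAdj n) c d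
  2≤gridDegree 3≤m =
    ≤-trans (2≤cycDegree m 3≤m c) (finDegree≤□-degree (cycAdj m) (pathAdj n) c d)

mainTheorem8 : (m n k g : ℕ) → m ≥ 3 → n ≥ 1 → k ≥ 1 →
    IsKRDomNumber k m n g →
    (k + 1) * m * n ≤ 5 * g
mainTheorem8 m n k g 3≤m _ 1≤k γ with IsKRDomNumber.attained γ
... | f , isKRDF , refl = begin
  (k + 1) * m * n                     ≡⟨ *-assoc (k + 1) m n ⟩
  (k + 1) * (m * n)                   ≡⟨ cong ((k + 1) *_) (length-allVertices {m} {n}) ⟨
  (k + 1) * length (allVertices m n)  ≤⟨ weight-bound 1≤k range dom 4
                                           (λ (c , d) → 2≤gridDegree c d 3≤m)
                                           (λ (c , d) → gridDegree≤4 c d) ⟩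
  5 * weight m n f                    ∎
  where
  open ≤-Reasoning
  open IsKRDF isKRDF
  -- adj m n is definitionally cycAdj m □ pathAdj n, so range and dom fit the general notions.
  open RomanDischarging (allVertices m n) (cycAdj m □ pathAdj n)
                        (□-sym (cycAdj-sym m) (pathAdj-sym n))
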